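{- For $i\in\{1,2\}$ let $\mathscr{G}_i^*$ be a $(k,r_i)$-regular hypergraph on $n_i$ vertices. If $\mathscr{G}_1^*$ is singular, then $\mathscr{G}_1^*\veebar\mathscr{G}_2^*$ is singular.
   Context: A $k$-uniform hypergraph has hyperedges that are $k$-element subsets of its vertex set; it is $(k,r)$-regular if every vertex lies in exactly $r$ hyperedges. Its adjacency matrix has $(i,j)$ entry equal to the number of hyperedges containing both the $i$-th and $j$-th vertex ($i\ne j$) and zero diagonal; a hypergraph is singular if $0$ is an eigenvalue of its adjacency matrix. For $\mathscr{G}^*=(V,E)$ with $V=\{v_1,\dots,v_n\}$, $NS(\mathscr{G}^*)$ has vertex set $V\cup S(\mathscr{G}^*)$, $S(\mathscr{G}^*)=\{u_1,\dots,u_n\}$ new vertices, and edge set $E\cup\{\{u_i\}\cup D: D\subset V\setminus\{v_i\}, |D|=k-1, \{v_i\}\cup D\in E\}$. For $k$-uniform $\mathscr{G}_1^*,\mathscr{G}_2^*$ on disjoint vertex sets, the neighbourhood splitting $V$-vertex join $\mathscr{G}_1^*\veebar\mathscr{G}_2^*$ has vertex set $V(\mathscr{G}_1^*)\cup S(\mathscr{G}_1^*)\cup V(\mathscr{G}_2^*)$ and edge set $E(NS(\mathscr{G}_1^*))\cup E(\mathscr{G}_2^*)\cup\{\{v\}\cup D: v\in V(\mathscr{G}_1^*),\ D\subset V(\mathscr{G}_2^*),\ |D|=k-1\}$. -}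

module Defs where

open import Data.Bool using (Bool; true; false; _∧_; _∨_; not; if_then_else_; T)
open import Data.Nat using (ℕ; zero; suc; _+_; _∸_; _≡ᵇ_)
open import Data.Integer using (ℤ; +_) renaming (_+_ to _+ℤ_; _*_ to _*ℤ_)
open import Data.Fin using (Fin; zero; suc) renaming (_≟_ to _≟F_)
open import Data.Fin.Subset using (Subset; ∣_∣; ⁅_⁆; _∪_)
open import Data.Vec using (Vec; []; _∷_; lookup; take; drop)
open import Data.List using (List; []; _∷_; map; _++_)
open import Data.Nat.ListAction using (sum)
open import Data.Product using (Σ; _×_; ∃)
open import Relation.Nullary using (¬_; does)
open import Relation.Binary.PropositionalEquality using (_≡_)

EdgeSet : ℕ → Set
EdgeSet n = Subset n → Bool

record Hypergraph (k n : ℕ) : Set where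
  field
    edges   : EdgeSet n
    uniform : ∀ s → T (edges s) → ∣ s ∣ ≡ k
open Hypergraph public

allSubsets : (n : ℕ) → List (Subset n)
allSubsets zero    = [] ∷ []
allSubsets (suc n) = map (false ∷_) (allSubsets n) ++ map (true ∷_) (allSubsets n)

countSubsets : {n : ℕ} → (Subset n → Bool) → ℕ
countSubsets {n} p = sum (map (λ s → if p s then 1 else 0) (allSubsets n))

degree : {n : ℕ} → EdgeSet n → Fin n → ℕ
degree E v = countSubsets (λ s → E s ∧ lookup s v)

Regular : {k n : ℕ} → Hypergraph k n → ℕ → Set
Regular G r = ∀ v → degree (edges G) v ≡ r

adjacency : {n : ℕ} → EdgeSet n → Fin n → Fin n → ℕ
adjacency E i j =
  if does (i ≟F j) then 0 else countSubsets (λ s → E s ∧ lookup s i ∧ lookup s j)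

∑ : {n : ℕ} → (Fin n → ℤ) → ℤ
∑ {zero}  f = + 0
∑ {suc n} f = f zero +ℤ ∑ (λ i → f (suc i))

-- 0 is an eigenvalue of the adjacency matrix: there is a nonzero vector x
-- with A x = 0 (vectors with integer entries).
Singular : {n : ℕ} → EdgeSet n → Set
Singular {n} E =
  Σ (Fin n → ℤ) λ x → (∃ λ i → ¬ (x i ≡ + 0)) ×
    (∀ i → ∑ (λ j → (+ adjacency E i j) *ℤ x j) ≡ + 0)

isEmpty : {n : ℕ} → Subset n → Bool
isEmpty s = ∣ s ∣ ≡ᵇ 0

anyFin : {n : ℕ} → (Fin n → Bool) → Bool
anyFin {zero}  p = false
anyFin {suc n} p = p zero ∨ anyFin (λ i → p (suc i))

-- Neighbourhood splitting V-vertex join of G1 (n1 vertices) and G2 (n2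
-- vertices).  Vertex set Fin (n1 + (n1 + n2)): the first n1 are
-- V(G1) = {v_1..v_n1}, the next n1 are S(G1) = {u_1..u_n1} (u_i the copy
-- of v_i), the last n2 are V(G2).
nsJoin : {k n1 n2 : ℕ} → Hypergraph k n1 → Hypergraph k n2 → EdgeSet (n1 + (n1 + n2))
nsJoin {k} {n1} {n2} G1 G2 s =
     (edges G1 a ∧ isEmpty b ∧ isEmpty c)
  ∨  (anyFin (λ i → lookup b i ∧ (∣ b ∣ ≡ᵇ 1) ∧ not (lookup a i)
                    ∧ edges G1 (a ∪ ⁅ i ⁆)) ∧ isEmpty c)     -- {u_i} ∪ D, {v_i} ∪ D ∈ E(G1), v_i ∉ D
  ∨  (isEmpty a ∧ isEmpty b ∧ edges G2 c)
  ∨  ((∣ a ∣ ≡ᵇ 1) ∧ isEmpty b ∧ (∣ c ∣ ≡ᵇ (k ∸ 1)))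
  where
    a : Subset n1
    a = take n1 s
    rest : Subset (n1 + n2)
    rest = drop n1 s
    b : Subset n1
    b = take n1 rest
    c : Subset n2
    c = drop n1 rest

-- Put a kernel vector x of A(G₁) on the split vertices u_i and zero elsewhere.
-- An edge through u_i is {u_i} ∪ D with D ⊆ V(G₁) and {v_i} ∪ D ∈ E(G₁), so it
-- contains no other u_j and no vertex of G₂; hence the only nonzero entries of
-- column u_i are A(v_j, u_i) = A₁(j, i), and A y = 0 follows from A₁ x = 0.

{-# OPTIONS --safe #-}
module Submission where

open import Defs
open import Data.Bool using (Bool; true; false; _∧_; _∨_; not; if_then_else_; T)
open import Data.Bool.Properties using (∧-zeroʳ; ∧-identityʳ; ∨-identityʳ; T-≡; T-∧)
open import Data.Fin using (Fin; zero; suc; _↑ˡ_; _↑ʳ_; splitAt) renaming (_≟_ to _≟ᶠ_)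
open import Data.Fin.Properties using (splitAt⁻¹-↑ˡ; splitAt⁻¹-↑ʳ; splitAt-↑ˡ; splitAt-↑ʳ)
open import Data.Fin.Subset using (Subset; ∣_∣; ⁅_⁆; ⊥; _∪_)
open import Data.Fin.Subset.Properties using (∣⁅x⁆∣≡1; ∣⊥∣≡0; ∪-identityʳ; x∈⁅y⁆⇒x≡y; x∈⁅x⁆)
open import Data.Integer using (ℤ; +_; 0ℤ) renaming (_+_ to _+ℤ_; _*_ to _*ℤ_)
import Data.Integer.Properties as ℤ
open import Data.List using (map) renaming (_++_ to _++ᴸ_)
open import Data.List.Properties using (map-++; map-∘; map-cong)
open import Data.Nat using (ℕ; zero; suc; _+_; _≡ᵇ_; _<_; z≤n; s≤s)
open import Data.Nat.ListAction using (sum)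
open import Data.Nat.ListAction.Properties using (sum-++)
open import Data.Nat.Properties using (+-identityʳ; +-comm; suc-injective; >⇒≢; ≡ᵇ⇒≡)
open import Data.Product using (_×_; ∃; _,_; proj₁; proj₂)
open import Data.Sum using (inj₁; inj₂)
open import Data.Vec using (Vec; []; _∷_; _++_; take; drop; lookup)
open import Data.Vec.Properties
  using (∷-injectiveʳ; ++-injective; take++drop≡id; lookup-++ˡ; lookup-++ʳ; lookup-replicate; lookup-zipWith;
         lookup⇒[]=; []=⇒lookup)
import Data.Vec.Functional as Vector
import Data.Vec.Functional.Properties as Vector
open import Function using (_∘_; Equivalence)
open import Relation.Nullary using (¬_; yes; no; contradiction)
open import Relation.Binary.PropositionalEquality

open Equivalence using (to)

𝟙 : Bool → ℕ
𝟙 b = if b then 1 else 0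

𝟙-¬T : ∀ {b} → ¬ T b → 𝟙 b ≡ 0
𝟙-¬T {false} _ = refl
𝟙-¬T {true} ¬T = contradiction _ ¬T

sumSubsets : (n : ℕ) → (Subset n → ℕ) → ℕ
sumSubsets n f = sum (map f (allSubsets n))

sumSubsets-cong : ∀ n {f g : Subset n → ℕ} → (∀ s → f s ≡ g s) → sumSubsets n f ≡ sumSubsets n g
sumSubsets-cong n f≗g = cong sum (map-cong f≗g (allSubsets n))

sumSubsets-suc : ∀ n (f : Subset (suc n) → ℕ) →
  sumSubsets (suc n) f ≡ sumSubsets n (f ∘ (false ∷_)) + sumSubsets n (f ∘ (true ∷_))
sumSubsets-suc n f = begin
  sum (map f (map (false ∷_) (allSubsets n) ++ᴸ map (true ∷_) (allSubsets n)))
    ≡⟨ cong sum (map-++ f (map (false ∷_) (allSubsets n)) _) ⟩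
  sum (map f (map (false ∷_) (allSubsets n)) ++ᴸ map f (map (true ∷_) (allSubsets n)))
    ≡⟨ sum-++ (map f (map (false ∷_) (allSubsets n))) _ ⟩
  sum (map f (map (false ∷_) (allSubsets n))) + sum (map f (map (true ∷_) (allSubsets n)))
    ≡⟨ sym (cong₂ _+_ (cong sum (map-∘ (allSubsets n))) (cong sum (map-∘ (allSubsets n)))) ⟩
  sumSubsets n (f ∘ (false ∷_)) + sumSubsets n (f ∘ (true ∷_)) ∎
  where open ≡-Reasoning

sumSubsets-zero : ∀ n {f : Subset n → ℕ} → (∀ s → f s ≡ 0) → sumSubsets n f ≡ 0
sumSubsets-zero zero    f≗0 = cong (_+ 0) (f≗0 [])
sumSubsets-zero (suc n) {f} f≗0 = trans (sumSubsets-suc n f)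
  (cong₂ _+_ (sumSubsets-zero n (f≗0 ∘ (false ∷_))) (sumSubsets-zero n (f≗0 ∘ (true ∷_))))

sumSubsets-single : ∀ n {f : Subset n → ℕ} s₀ → (∀ s → s ≢ s₀ → f s ≡ 0) → sumSubsets n f ≡ f s₀
sumSubsets-single zero    {f} [] _ = +-identityʳ (f [])
sumSubsets-single (suc n) {f} (false ∷ s₀) vanishes = begin
  sumSubsets (suc n) f                                  ≡⟨ sumSubsets-suc n f ⟩
  sumSubsets n (f ∘ (false ∷_)) + sumSubsets n (f ∘ (true ∷_))
    ≡⟨ cong₂ _+_ (sumSubsets-single n s₀ λ s s≢s₀ → vanishes (false ∷ s) (s≢s₀ ∘ ∷-injectiveʳ))
                 (sumSubsets-zero n λ s → vanishes (true ∷ s) λ ()) ⟩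
  f (false ∷ s₀) + 0                                    ≡⟨ +-identityʳ _ ⟩
  f (false ∷ s₀)                                        ∎
  where open ≡-Reasoning
sumSubsets-single (suc n) {f} (true ∷ s₀) vanishes = trans (sumSubsets-suc n f)
  (cong₂ _+_ (sumSubsets-zero n λ s → vanishes (false ∷ s) λ ())
             (sumSubsets-single n s₀ λ s s≢s₀ → vanishes (true ∷ s) (s≢s₀ ∘ ∷-injectiveʳ)))

sumSubsets-++ : ∀ m n (f : Subset (m + n) → ℕ) →
  sumSubsets (m + n) f ≡ sumSubsets m (λ a → sumSubsets n (λ b → f (a ++ b)))
sumSubsets-++ zero    n f = sym (+-identityʳ _)
sumSubsets-++ (suc m) n f = begin
  sumSubsets (suc m + n) f
    ≡⟨ sumSubsets-suc (m + n) f ⟩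
  sumSubsets (m + n) (f ∘ (false ∷_)) + sumSubsets (m + n) (f ∘ (true ∷_))
    ≡⟨ cong₂ _+_ (sumSubsets-++ m n (f ∘ (false ∷_))) (sumSubsets-++ m n (f ∘ (true ∷_))) ⟩
  sumSubsets m (λ a → sumSubsets n (λ b → f (false ∷ a ++ b)))
    + sumSubsets m (λ a → sumSubsets n (λ b → f (true ∷ a ++ b)))
    ≡⟨ sym (sumSubsets-suc m _) ⟩
  sumSubsets (suc m) (λ a → sumSubsets n (λ b → f (a ++ b))) ∎
  where open ≡-Reasoning

sumSubsets-∪⁅⁆ : ∀ n (i : Fin n) (g : Subset n → ℕ) →
  sumSubsets n (λ a → if lookup a i then 0 else g (a ∪ ⁅ i ⁆)) ≡
  sumSubsets n (λ e → if lookup e i then g e else 0)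
sumSubsets-∪⁅⁆ (suc n) zero g = begin
  sumSubsets (suc n) (λ a → if lookup a zero then 0 else g (a ∪ ⁅ zero ⁆))
    ≡⟨ sumSubsets-suc n _ ⟩
  sumSubsets n (λ s → g (true ∷ s ∪ ⊥)) + sumSubsets n (λ _ → 0)
    ≡⟨ cong₂ _+_ (sumSubsets-cong n λ s → cong (g ∘ (true ∷_)) (∪-identityʳ s))
                 (sumSubsets-zero n λ _ → refl) ⟩
  sumSubsets n (g ∘ (true ∷_)) + 0
    ≡⟨ +-comm _ 0 ⟩
  0 + sumSubsets n (g ∘ (true ∷_))
    ≡⟨ cong (_+ sumSubsets n (g ∘ (true ∷_))) (sym (sumSubsets-zero n λ _ → refl)) ⟩
  sumSubsets n (λ _ → 0) + sumSubsets n (g ∘ (true ∷_))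
    ≡⟨ sym (sumSubsets-suc n _) ⟩
  sumSubsets (suc n) (λ e → if lookup e zero then g e else 0) ∎
  where open ≡-Reasoning
sumSubsets-∪⁅⁆ (suc n) (suc i) g = trans (sumSubsets-suc n _) (trans
  (cong₂ _+_ (sumSubsets-∪⁅⁆ n i (g ∘ (false ∷_))) (sumSubsets-∪⁅⁆ n i (g ∘ (true ∷_))))
  (sym (sumSubsets-suc n _)))

countSubsets-≡0 : ∀ {n} (p : Subset n → Bool) → (∀ s → ¬ T (p s)) → countSubsets p ≡ 0
countSubsets-≡0 {n} p ¬p = sumSubsets-zero n (𝟙-¬T ∘ ¬p)

∑-cong : ∀ {n} {f g : Fin n → ℤ} → (∀ i → f i ≡ g i) → ∑ f ≡ ∑ g
∑-cong {zero}  f≗g = refl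
∑-cong {suc n} f≗g = cong₂ _+ℤ_ (f≗g zero) (∑-cong (f≗g ∘ suc))

∑-zero : ∀ {n} {f : Fin n → ℤ} → (∀ i → f i ≡ 0ℤ) → ∑ f ≡ 0ℤ
∑-zero {zero}  _   = refl
∑-zero {suc n} f≗0 = cong₂ _+ℤ_ (f≗0 zero) (∑-zero (f≗0 ∘ suc))

∑-++ : ∀ m {n} (f : Fin (m + n) → ℤ) → ∑ f ≡ ∑ (λ i → f (i ↑ˡ n)) +ℤ ∑ (λ j → f (m ↑ʳ j))
∑-++ zero    f = sym (ℤ.+-identityˡ _)
∑-++ (suc m) f = trans (cong (f zero +ℤ_) (∑-++ m (f ∘ suc))) (sym (ℤ.+-assoc (f zero) _ _))

∑-*-zeros-++ : ∀ m {n} (f : Fin (m + n) → ℤ) (g : Fin n → ℤ) →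
  ∑ (λ c → f c *ℤ (Vector.replicate m 0ℤ Vector.++ g) c) ≡ ∑ (λ j → f (m ↑ʳ j) *ℤ g j)
∑-*-zeros-++ m {n} f g = begin
  ∑ (λ c → f c *ℤ h c)
    ≡⟨ ∑-++ m (λ c → f c *ℤ h c) ⟩
  ∑ (λ i → f (i ↑ˡ n) *ℤ h (i ↑ˡ n)) +ℤ ∑ (λ j → f (m ↑ʳ j) *ℤ h (m ↑ʳ j))
    ≡⟨ cong₂ _+ℤ_ (∑-zero left) (∑-cong right) ⟩
  0ℤ +ℤ ∑ (λ j → f (m ↑ʳ j) *ℤ g j)
    ≡⟨ ℤ.+-identityˡ _ ⟩
  ∑ (λ j → f (m ↑ʳ j) *ℤ g j) ∎
  where
  open ≡-Reasoning
  zeros = Vector.replicate m 0ℤ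
  h = zeros Vector.++ g
  left : ∀ i → f (i ↑ˡ n) *ℤ h (i ↑ˡ n) ≡ 0ℤ
  left i = trans (cong (f (i ↑ˡ n) *ℤ_) (Vector.lookup-++ˡ zeros g i)) (ℤ.*-zeroʳ (f (i ↑ˡ n)))
  right : ∀ j → f (m ↑ʳ j) *ℤ h (m ↑ʳ j) ≡ f (m ↑ʳ j) *ℤ g j
  right j = cong (f (m ↑ʳ j) *ℤ_) (Vector.lookup-++ʳ zeros g j)

∑-*-++-zeros : ∀ {m} n (f : Fin (m + n) → ℤ) (g : Fin m → ℤ) →
  ∑ (λ c → f c *ℤ (g Vector.++ Vector.replicate n 0ℤ) c) ≡ ∑ (λ i → f (i ↑ˡ n) *ℤ g i)
∑-*-++-zeros {m} n f g = begin
  ∑ (λ c → f c *ℤ h c)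
    ≡⟨ ∑-++ m (λ c → f c *ℤ h c) ⟩
  ∑ (λ i → f (i ↑ˡ n) *ℤ h (i ↑ˡ n)) +ℤ ∑ (λ j → f (m ↑ʳ j) *ℤ h (m ↑ʳ j))
    ≡⟨ cong₂ _+ℤ_ (∑-cong left) (∑-zero right) ⟩
  ∑ (λ i → f (i ↑ˡ n) *ℤ g i) +ℤ 0ℤ
    ≡⟨ ℤ.+-identityʳ _ ⟩
  ∑ (λ i → f (i ↑ˡ n) *ℤ g i) ∎
  where
  open ≡-Reasoning
  zeros = Vector.replicate n 0ℤ
  h = g Vector.++ zeros
  left : ∀ i → f (i ↑ˡ n) *ℤ h (i ↑ˡ n) ≡ f (i ↑ˡ n) *ℤ g i
  left i = cong (f (i ↑ˡ n) *ℤ_) (Vector.lookup-++ˡ g zeros i)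
  right : ∀ j → f (m ↑ʳ j) *ℤ h (m ↑ʳ j) ≡ 0ℤ
  right j = trans (cong (f (m ↑ʳ j) *ℤ_) (Vector.lookup-++ʳ g zeros j)) (ℤ.*-zeroʳ (f (m ↑ʳ j)))

↑-elim : ∀ {m n} (P : Fin (m + n) → Set) →
  (∀ i → P (i ↑ˡ n)) → (∀ j → P (m ↑ʳ j)) → ∀ r → P r
↑-elim {m} P left right r with splitAt m r in eq
... | inj₁ i = subst P (splitAt⁻¹-↑ˡ eq) (left i)
... | inj₂ j = subst P (splitAt⁻¹-↑ʳ eq) (right j)

take-drop-++ : ∀ {A : Set} {m n} (xs : Vec A m) (ys : Vec A n) →
  take m (xs ++ ys) ≡ xs × drop m (xs ++ ys) ≡ ys
take-drop-++ {m = m} xs ys = ++-injective (take m (xs ++ ys)) xs (take++drop≡id m (xs ++ ys))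

∀-++ : ∀ {A : Set} m {n} (P : Vec A (m + n) → Set) → (∀ xs ys → P (xs ++ ys)) → ∀ zs → P zs
∀-++ m P h zs = subst P (take++drop≡id m zs) (h (take m zs) (drop m zs))

lookup⇒0<∣p∣ : ∀ {n} (p : Subset n) i → T (lookup p i) → 0 < ∣ p ∣
lookup⇒0<∣p∣ (true  ∷ p) zero    _ = s≤s z≤n
lookup⇒0<∣p∣ (true  ∷ p) (suc i) _ = s≤s z≤n
lookup⇒0<∣p∣ (false ∷ p) (suc i) h = lookup⇒0<∣p∣ p i h

∣p∣≡0⇒p≡⊥ : ∀ {n} (p : Subset n) → ∣ p ∣ ≡ 0 → p ≡ ⊥
∣p∣≡0⇒p≡⊥ []          _  = refl
∣p∣≡0⇒p≡⊥ (false ∷ p) ∣p∣≡0 = cong (false ∷_) (∣p∣≡0⇒p≡⊥ p ∣p∣≡0)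

∣p∣≡1⇒p≡⁅x⁆ : ∀ {n} (p : Subset n) x → T (lookup p x) → ∣ p ∣ ≡ 1 → p ≡ ⁅ x ⁆
∣p∣≡1⇒p≡⁅x⁆ (true  ∷ p) zero    _ ∣p∣≡1 = cong (true ∷_) (∣p∣≡0⇒p≡⊥ p (suc-injective ∣p∣≡1))
∣p∣≡1⇒p≡⁅x⁆ (true  ∷ p) (suc x) h ∣p∣≡1 =
  contradiction (suc-injective ∣p∣≡1) (>⇒≢ (lookup⇒0<∣p∣ p x h))
∣p∣≡1⇒p≡⁅x⁆ (false ∷ p) (suc x) h ∣p∣≡1 = cong (false ∷_) (∣p∣≡1⇒p≡⁅x⁆ p x h ∣p∣≡1)

lookup⇒¬isEmpty : ∀ {n} (p : Subset n) i → T (lookup p i) → isEmpty p ≡ false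
lookup⇒¬isEmpty p i h with ∣ p ∣ | lookup⇒0<∣p∣ p i h
... | suc _ | _ = refl

isEmpty⇒≡⊥ : ∀ {n} (p : Subset n) → T (isEmpty p) → p ≡ ⊥
isEmpty⇒≡⊥ p h = ∣p∣≡0⇒p≡⊥ p (≡ᵇ⇒≡ ∣ p ∣ 0 h)

isEmpty-⊥ : ∀ n → isEmpty (⊥ {n}) ≡ true
isEmpty-⊥ n = cong (_≡ᵇ 0) (∣⊥∣≡0 n)

isEmpty-⁅x⁆ : ∀ {n} (x : Fin n) → isEmpty ⁅ x ⁆ ≡ false
isEmpty-⁅x⁆ x = cong (_≡ᵇ 0) (∣⁅x⁆∣≡1 x)

¬T-lookup-⊥ : ∀ {n} (x : Fin n) → ¬ T (lookup ⊥ x)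
¬T-lookup-⊥ x h = subst T (lookup-replicate x false) h

T-lookup-⁅y⁆ : ∀ {n} {x : Fin n} y → T (lookup ⁅ y ⁆ x) → x ≡ y
T-lookup-⁅y⁆ {x = x} y h = x∈⁅y⁆⇒x≡y y (lookup⇒[]= x ⁅ y ⁆ (to T-≡ h))

lookup-⁅x⁆ : ∀ {n} (x : Fin n) → lookup ⁅ x ⁆ x ≡ true
lookup-⁅x⁆ x = []=⇒lookup (x∈⁅x⁆ x)

lookup-∪⁅y⁆ : ∀ {n} (p : Subset n) {x y : Fin n} → x ≢ y → lookup (p ∪ ⁅ y ⁆) x ≡ lookup p x
lookup-∪⁅y⁆ p {x} {y} x≢y = begin
  lookup (p ∪ ⁅ y ⁆) x          ≡⟨ lookup-zipWith _∨_ x p ⁅ y ⁆ ⟩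
  lookup p x ∨ lookup ⁅ y ⁆ x   ≡⟨ cong (lookup p x ∨_) ⁅y⁆x≡false ⟩
  lookup p x ∨ false            ≡⟨ ∨-identityʳ _ ⟩
  lookup p x                    ∎
  where
  open ≡-Reasoning
  ⁅y⁆x≡false : lookup ⁅ y ⁆ x ≡ false
  ⁅y⁆x≡false with lookup ⁅ y ⁆ x in eq
  ... | false = refl
  ... | true  = contradiction (T-lookup-⁅y⁆ y (subst T (sym eq) _)) x≢y

anyFin-sound : ∀ {n} (p : Fin n → Bool) → T (anyFin p) → ∃ λ i → T (p i)
anyFin-sound {suc n} p h with p zero in eq
... | true  = zero , subst T (sym eq) _
... | false with anyFin-sound (p ∘ suc) h
...   | i , pi = suc i , pi

anyFin-⁅y⁆ : ∀ {n} (y : Fin n) (q : Fin n → Bool) → anyFin (λ x → lookup ⁅ y ⁆ x ∧ q x) ≡ q y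
anyFin-⁅y⁆ zero    q = trans (cong (q zero ∨_) (anyFin-⊥ (q ∘ suc))) (∨-identityʳ (q zero))
  where
  anyFin-⊥ : ∀ {n} (q : Fin n → Bool) → anyFin (λ x → lookup ⊥ x ∧ q x) ≡ false
  anyFin-⊥ {zero}  q = refl
  anyFin-⊥ {suc n} q = anyFin-⊥ (q ∘ suc)
anyFin-⁅y⁆ (suc y) q = anyFin-⁅y⁆ y (q ∘ suc)

adjacency-≢ : ∀ {n} (E : EdgeSet n) {x y} → x ≢ y →
  adjacency E x y ≡ countSubsets (λ s → E s ∧ lookup s x ∧ lookup s y)
adjacency-≢ E {x} {y} x≢y with x ≟ᶠ y
... | yes x≡y = contradiction x≡y x≢y
... | no  _   = refl

CommonEdge : ∀ {n} → EdgeSet n → Fin n → Fin n → Subset n → Set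
CommonEdge E x y s = T (E s) × T (lookup s x) × T (lookup s y)

adjacency-≡0 : ∀ {n} (E : EdgeSet n) {x y} →
  (x ≢ y → ∀ s → ¬ CommonEdge E x y s) → adjacency E x y ≡ 0
adjacency-≡0 E {x} {y} noEdge with x ≟ᶠ y
... | yes _   = refl
... | no  x≢y = countSubsets-≡0 _ λ s h →
  let e , xy = to (T-∧ {E s}) h in noEdge x≢y s (e , to (T-∧ {lookup s x}) xy)

adjacency-∪⁅⁆ : ∀ {n} (E : EdgeSet n) j i →
  sumSubsets n (λ a → 𝟙 ((not (lookup a i) ∧ E (a ∪ ⁅ i ⁆)) ∧ lookup a j)) ≡ adjacency E j i
adjacency-∪⁅⁆ {n} E j i with j ≟ᶠ i
... | yes refl = sumSubsets-zero n λ a → 𝟙-¬T (notAndSelf a)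
  where
  notAndSelf : ∀ a → ¬ T ((not (lookup a i) ∧ E (a ∪ ⁅ i ⁆)) ∧ lookup a i)
  notAndSelf a with lookup a i
  ... | true  = λ ()
  ... | false = λ h → subst T (∧-zeroʳ (E (a ∪ ⁅ i ⁆))) h
... | no j≢i = begin
  sumSubsets n (λ a → 𝟙 ((not (lookup a i) ∧ E (a ∪ ⁅ i ⁆)) ∧ lookup a j))
    ≡⟨ sumSubsets-cong n avoiding ⟩
  sumSubsets n (λ a → if lookup a i then 0 else g (a ∪ ⁅ i ⁆))
    ≡⟨ sumSubsets-∪⁅⁆ n i g ⟩
  sumSubsets n (λ e → if lookup e i then g e else 0)
    ≡⟨ sumSubsets-cong n through ⟩
  countSubsets (λ e → E e ∧ lookup e j ∧ lookup e i) ∎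
  where
  open ≡-Reasoning
  g : Subset n → ℕ
  g e = 𝟙 (E e ∧ lookup e j)
  avoiding : ∀ a → 𝟙 ((not (lookup a i) ∧ E (a ∪ ⁅ i ⁆)) ∧ lookup a j) ≡
                   (if lookup a i then 0 else g (a ∪ ⁅ i ⁆))
  avoiding a with lookup a i
  ... | true  = refl
  ... | false = cong (𝟙 ∘ (E (a ∪ ⁅ i ⁆) ∧_)) (sym (lookup-∪⁅y⁆ a j≢i))
  through : ∀ e → (if lookup e i then g e else 0) ≡ 𝟙 (E e ∧ lookup e j ∧ lookup e i)
  through e with lookup e i
  ... | true  = cong (𝟙 ∘ (E e ∧_)) (sym (∧-identityʳ (lookup e j)))
  ... | false = cong 𝟙 (sym (trans (cong (E e ∧_) (∧-zeroʳ (lookup e j))) (∧-zeroʳ (E e))))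

module NSJoin {k n₁ n₂ : ℕ} (G₁ : Hypergraph k n₁) (G₂ : Hypergraph k n₂) where

  v u : Fin n₁ → Fin (n₁ + (n₁ + n₂))
  v j = j ↑ˡ (n₁ + n₂)
  u i = n₁ ↑ʳ (i ↑ˡ n₂)

  w : Fin n₂ → Fin (n₁ + (n₁ + n₂))
  w t = n₁ ↑ʳ (n₁ ↑ʳ t)

  module _ (a b : Subset n₁) (c : Subset n₂) where

    lookup-v : ∀ j → lookup (a ++ (b ++ c)) (v j) ≡ lookup a j
    lookup-v j = lookup-++ˡ a (b ++ c) j

    lookup-u : ∀ i → lookup (a ++ (b ++ c)) (u i) ≡ lookup b i
    lookup-u i = trans (lookup-++ʳ a (b ++ c) (i ↑ˡ n₂)) (lookup-++ˡ b c i)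

    lookup-w : ∀ t → lookup (a ++ (b ++ c)) (w t) ≡ lookup c t
    lookup-w t = trans (lookup-++ʳ a (b ++ c) (n₁ ↑ʳ t)) (lookup-++ʳ b c t)

  -- The edges {u_i} ∪ D of NS(G₁), written in the blocks (a, b) = (D, ⁅ i ⁆).
  splitEdgeAt : Subset n₁ → Subset n₁ → Fin n₁ → Bool
  splitEdgeAt a b i = lookup b i ∧ (∣ b ∣ ≡ᵇ 1) ∧ not (lookup a i) ∧ edges G₁ (a ∪ ⁅ i ⁆)

  splitEdge : Subset n₁ → Subset n₁ → Bool
  splitEdge a b = anyFin (splitEdgeAt a b)

  splitEdge⇒∣b∣≡1 : ∀ a b → T (splitEdge a b) → ∣ b ∣ ≡ 1
  splitEdge⇒∣b∣≡1 a b h with anyFin-sound (splitEdgeAt a b) h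
  ... | i , at = ≡ᵇ⇒≡ ∣ b ∣ 1 (proj₁ (to T-∧ (proj₂ (to (T-∧ {lookup b i}) at))))

  splitEdge-⁅i⁆ : ∀ a i → splitEdge a ⁅ i ⁆ ≡ not (lookup a i) ∧ edges G₁ (a ∪ ⁅ i ⁆)
  splitEdge-⁅i⁆ a i rewrite ∣⁅x⁆∣≡1 i = anyFin-⁅y⁆ i (λ x → not (lookup a x) ∧ edges G₁ (a ∪ ⁅ x ⁆))

  nsJoin-b≢∅ : ∀ a b c → isEmpty b ≡ false →
               nsJoin G₁ G₂ (a ++ (b ++ c)) ≡ splitEdge a b ∧ isEmpty c
  nsJoin-b≢∅ a b c b≢∅
    rewrite proj₁ (take-drop-++ a (b ++ c)) | proj₂ (take-drop-++ a (b ++ c))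
          | proj₁ (take-drop-++ b c) | proj₂ (take-drop-++ b c) | b≢∅
    = ∨-second (edges G₁ a) (splitEdge a b ∧ isEmpty c) (isEmpty a) (∣ a ∣ ≡ᵇ 1)
    where
    ∨-second : ∀ p q r t → (p ∧ false) ∨ q ∨ (r ∧ false) ∨ (t ∧ false) ≡ q
    ∨-second p q r t rewrite ∧-zeroʳ p | ∧-zeroʳ r | ∧-zeroʳ t = ∨-identityʳ q

  edge∋u⇒b≡⁅i⁆×c≡⊥ : ∀ a b c i → T (lookup b i) → T (nsJoin G₁ G₂ (a ++ (b ++ c))) →
                      b ≡ ⁅ i ⁆ × c ≡ ⊥
  edge∋u⇒b≡⁅i⁆×c≡⊥ a b c i bi e =
    let e′ = subst T (nsJoin-b≢∅ a b c (lookup⇒¬isEmpty b i bi)) e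
        split , c≡∅ = to (T-∧ {splitEdge a b}) e′
    in ∣p∣≡1⇒p≡⁅x⁆ b i bi (splitEdge⇒∣b∣≡1 a b split) , isEmpty⇒≡⊥ c c≡∅

  nsJoin-⁅i⁆-⊥ : ∀ a i → nsJoin G₁ G₂ (a ++ (⁅ i ⁆ ++ ⊥)) ≡ not (lookup a i) ∧ edges G₁ (a ∪ ⁅ i ⁆)
  nsJoin-⁅i⁆-⊥ a i = begin
    nsJoin G₁ G₂ (a ++ (⁅ i ⁆ ++ ⊥))   ≡⟨ nsJoin-b≢∅ a ⁅ i ⁆ ⊥ (isEmpty-⁅x⁆ i) ⟩
    splitEdge a ⁅ i ⁆ ∧ isEmpty (⊥ {n₂})
                                        ≡⟨ cong₂ _∧_ (splitEdge-⁅i⁆ a i) (isEmpty-⊥ n₂) ⟩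
    (not (lookup a i) ∧ edges G₁ (a ∪ ⁅ i ⁆)) ∧ true
                                        ≡⟨ ∧-identityʳ (not (lookup a i) ∧ edges G₁ (a ∪ ⁅ i ⁆)) ⟩
    not (lookup a i) ∧ edges G₁ (a ∪ ⁅ i ⁆) ∎
    where open ≡-Reasoning

  countSubsets-blocks : (p : Subset (n₁ + (n₁ + n₂)) → Bool) → countSubsets p ≡
    sumSubsets n₁ λ a → sumSubsets n₁ λ b → sumSubsets n₂ λ c → 𝟙 (p (a ++ (b ++ c)))
  countSubsets-blocks p =
    trans (sumSubsets-++ n₁ (n₁ + n₂) _) (sumSubsets-cong n₁ λ a → sumSubsets-++ n₁ n₂ _)

  ∀-blocks : (P : Subset (n₁ + (n₁ + n₂)) → Set) → (∀ a b c → P (a ++ (b ++ c))) → ∀ s → P s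
  ∀-blocks P h = ∀-++ n₁ P λ a → ∀-++ n₁ (P ∘ (a ++_)) (h a)

  v≢u : ∀ j i → v j ≢ u i
  v≢u j i vj≡ui with trans (sym (splitAt-↑ˡ n₁ j (n₁ + n₂)))
                         (trans (cong (splitAt n₁) vj≡ui) (splitAt-↑ʳ n₁ (n₁ + n₂) (i ↑ˡ n₂)))
  ... | ()

  adjacency-u-u : ∀ j i → adjacency (nsJoin G₁ G₂) (u j) (u i) ≡ 0
  adjacency-u-u j i = adjacency-≡0 (nsJoin G₁ G₂) λ uj≢ui →
    ∀-blocks (¬_ ∘ CommonEdge (nsJoin G₁ G₂) (u j) (u i)) λ a b c (e , bj , bi) →
    let b≡⁅i⁆ , _ = edge∋u⇒b≡⁅i⁆×c≡⊥ a b c i (subst T (lookup-u a b c i) bi) e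
        ⁅i⁆∋j = subst (λ b → T (lookup b j)) b≡⁅i⁆ (subst T (lookup-u a b c j) bj)
    in uj≢ui (cong u (T-lookup-⁅y⁆ i ⁅i⁆∋j))

  adjacency-w-u : ∀ t i → adjacency (nsJoin G₁ G₂) (w t) (u i) ≡ 0
  adjacency-w-u t i = adjacency-≡0 (nsJoin G₁ G₂) λ _ →
    ∀-blocks (¬_ ∘ CommonEdge (nsJoin G₁ G₂) (w t) (u i)) λ a b c (e , ct , bi) →
    let _ , c≡⊥ = edge∋u⇒b≡⁅i⁆×c≡⊥ a b c i (subst T (lookup-u a b c i) bi) e
    in ¬T-lookup-⊥ t (subst (λ c → T (lookup c t)) c≡⊥ (subst T (lookup-w a b c t) ct))

  adjacency-v-u : ∀ j i → adjacency (nsJoin G₁ G₂) (v j) (u i) ≡ adjacency (edges G₁) j i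
  adjacency-v-u j i = begin
    adjacency (nsJoin G₁ G₂) (v j) (u i)
      ≡⟨ adjacency-≢ (nsJoin G₁ G₂) (v≢u j i) ⟩
    countSubsets (λ s → nsJoin G₁ G₂ s ∧ lookup s (v j) ∧ lookup s (u i))
      ≡⟨ countSubsets-blocks _ ⟩
    sumSubsets n₁ (λ a → sumSubsets n₁ λ b → sumSubsets n₂ λ c → term a b c)
      ≡⟨ sumSubsets-cong n₁ only-⁅i⁆-⊥ ⟩
    sumSubsets n₁ (λ a → 𝟙 ((not (lookup a i) ∧ edges G₁ (a ∪ ⁅ i ⁆)) ∧ lookup a j))
      ≡⟨ adjacency-∪⁅⁆ (edges G₁) j i ⟩
    adjacency (edges G₁) j i ∎
    where
    open ≡-Reasoning
    term : Subset n₁ → Subset n₁ → Subset n₂ → ℕ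
    term a b c = let s = a ++ (b ++ c) in 𝟙 (nsJoin G₁ G₂ s ∧ lookup s (v j) ∧ lookup s (u i))
    term-≡0 : ∀ a b c → ¬ (b ≡ ⁅ i ⁆ × c ≡ ⊥) → term a b c ≡ 0
    term-≡0 a b c ¬S = 𝟙-¬T λ h →
      let e , vj∧ui = to (T-∧ {nsJoin G₁ G₂ (a ++ (b ++ c))}) h
          _ , ui = to (T-∧ {lookup (a ++ (b ++ c)) (v j)}) vj∧ui
      in ¬S (edge∋u⇒b≡⁅i⁆×c≡⊥ a b c i (subst T (lookup-u a b c i) ui) e)
    only-⁅i⁆-⊥ : ∀ a → sumSubsets n₁ (λ b → sumSubsets n₂ λ c → term a b c) ≡
                        𝟙 ((not (lookup a i) ∧ edges G₁ (a ∪ ⁅ i ⁆)) ∧ lookup a j)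
    only-⁅i⁆-⊥ a = begin
      sumSubsets n₁ (λ b → sumSubsets n₂ λ c → term a b c)
        ≡⟨ sumSubsets-single n₁ ⁅ i ⁆ (λ b b≢⁅i⁆ →
             sumSubsets-zero n₂ λ c → term-≡0 a b c (b≢⁅i⁆ ∘ proj₁)) ⟩
      sumSubsets n₂ (λ c → term a ⁅ i ⁆ c)
        ≡⟨ sumSubsets-single n₂ ⊥ (λ c c≢⊥ → term-≡0 a ⁅ i ⁆ c (c≢⊥ ∘ proj₂)) ⟩
      term a ⁅ i ⁆ ⊥
        ≡⟨ cong 𝟙 (cong₂ _∧_ (nsJoin-⁅i⁆-⊥ a i)
             (cong₂ _∧_ (lookup-v a ⁅ i ⁆ ⊥ j) (trans (lookup-u a ⁅ i ⁆ ⊥ i) (lookup-⁅x⁆ i)))) ⟩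
      𝟙 ((not (lookup a i) ∧ edges G₁ (a ∪ ⁅ i ⁆)) ∧ lookup a j ∧ true)
        ≡⟨ cong (𝟙 ∘ ((not (lookup a i) ∧ edges G₁ (a ∪ ⁅ i ⁆)) ∧_)) (∧-identityʳ (lookup a j)) ⟩
      𝟙 ((not (lookup a i) ∧ edges G₁ (a ∪ ⁅ i ⁆)) ∧ lookup a j) ∎

  liftS : (Fin n₁ → ℤ) → Fin (n₁ + (n₁ + n₂)) → ℤ
  liftS x = Vector.replicate n₁ 0ℤ Vector.++ (x Vector.++ Vector.replicate n₂ 0ℤ)

  liftS-u : ∀ x i → liftS x (u i) ≡ x i
  liftS-u x i = trans (Vector.lookup-++ʳ (Vector.replicate n₁ 0ℤ) _ (i ↑ˡ n₂))
                      (Vector.lookup-++ˡ x (Vector.replicate n₂ 0ℤ) i)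

  ∑-*-liftS : ∀ (f : Fin (n₁ + (n₁ + n₂)) → ℤ) x →
              ∑ (λ c → f c *ℤ liftS x c) ≡ ∑ (λ i → f (u i) *ℤ x i)
  ∑-*-liftS f x = trans (∑-*-zeros-++ n₁ f _) (∑-*-++-zeros n₂ (f ∘ (n₁ ↑ʳ_)) x)

  liftS-kernel : ∀ x → (∀ j → ∑ (λ i → + adjacency (edges G₁) j i *ℤ x i) ≡ 0ℤ) →
    ∀ r → ∑ (λ c → + adjacency (nsJoin G₁ G₂) r c *ℤ liftS x c) ≡ 0ℤ
  liftS-kernel x A₁x≡0 r = trans (∑-*-liftS (λ c → + adjacency (nsJoin G₁ G₂) r c) x)
                                 (↑-elim Row row-v (↑-elim (Row ∘ (n₁ ↑ʳ_)) row-u row-w) r)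
    where
    Row : Fin (n₁ + (n₁ + n₂)) → Set
    Row r = ∑ (λ i → + adjacency (nsJoin G₁ G₂) r (u i) *ℤ x i) ≡ 0ℤ
    row-v : ∀ j → Row (v j)
    row-v j = trans (∑-cong λ i → cong (λ a → + a *ℤ x i) (adjacency-v-u j i)) (A₁x≡0 j)
    row-u : ∀ j → Row (u j)
    row-u j = ∑-zero λ i → cong (λ a → + a *ℤ x i) (adjacency-u-u j i)
    row-w : ∀ t → Row (w t)
    row-w t = ∑-zero λ i → cong (λ a → + a *ℤ x i) (adjacency-w-u t i)

corollary4p2 : (k r₁ r₂ n₁ n₂ : ℕ) (G₁ : Hypergraph k n₁) (G₂ : Hypergraph k n₂) →
    Regular G₁ r₁ → Regular G₂ r₂ →
    Singular (edges G₁) → Singular (nsJoin G₁ G₂)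
corollary4p2 k r₁ r₂ n₁ n₂ G₁ G₂ _ _ (x , (i , xᵢ≢0) , A₁x≡0) =
  liftS x , (u i , xᵢ≢0 ∘ trans (sym (liftS-u x i))) , liftS-kernel x A₁x≡0
  where open NSJoin G₁ G₂
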